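{- Let $T$ be a binary $r \times c$ row-column design on $v$ symbols ($r,c\ge 2$). Suppose there exist integers $x, x_{rc}, x_{rr}, x_{cc}$ such that (1) every symbol occurs $x$ or $x+1$ times in $T$; (2) every row and every column have $x_{rc}$ or $x_{rc}+1$ common symbols; (3) every two distinct rows have $x_{rr}$ or $x_{rr}+1$ common symbols; (4) every two distinct columns have $x_{cc}$ or $x_{cc}+1$ common symbols. Then $T$ is an $(r\times c,v)$-near triple array. Conversely, every $(r\times c,v)$-near triple array satisfies (1)–(4) for some integers $x, x_{rc}, x_{rr}, x_{cc}$.
   Context: An $r\times c$ row-column design on $v$ symbols is an $r\times c$ array each of whose cells is filled with one of $v$ symbols (symbols may be unused, in which case they occur $0$ times). It is binary if no symbol occurs more than once in any row or in any column. Let $e=rc/v$, $e^-=\lfloor e\rfloor$, $e^+=\lceil e\rceil$. The design is equireplicate if $e$ is an integer and every symbol occurs exactly $e$ times, and near equireplicate if $e$ is not an integer and every symbol occurs $e^-$ or $e^+$ times. For a binary design, let $R_i$, $C_j$ be the symbol sets of row $i$ and column $j$, and put $\lambda_{rc}=\frac{1}{rc}\sum_{i,j}|R_i\cap C_j|$, $\lambda_{rr}=\binom{r}{2}^{ -1}\sum_{i<j}|R_i\cap R_j|$, $\lambda_{cc}=\binom{c}{2}^{ -1}\sum_{i<j}|C_i\cap C_j|$; for real $x$, $x^-=\lfloor x\rfloor$, $x^+=\lceil x\rceil$. An $(r\times c,v)$-near triple array is a binary $r\times c$ row-column design on $v$ symbols which is equireplicate or near equireplicate and in which every row and column share $\lambda_{rc}^-$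 or $\lambda_{rc}^+$ symbols, every two distinct rows share $\lambda_{rr}^-$ or $\lambda_{rr}^+$ symbols, and every two distinct columns share $\lambda_{cc}^-$ or $\lambda_{cc}^+$ symbols. -}

module Defs where

open import Data.Nat using (ℕ; zero; suc; _+_; _*_; _∸_; _≤_)
open import Data.Nat.DivMod using (_/_)
open import Data.Nat.Divisibility using (_∣_)
open import Data.Nat.Combinatorics using (_C_)
open import Data.Integer using (ℤ; +_)
import Data.Integer as ℤ
open import Data.Fin using (Fin; _<_)
open import Data.Fin.Properties using (_≟_; _<?_)
open import Data.Fin.Subset using (Subset; ⁅_⁆; ⋃; _∩_; ∣_∣)
open import Data.List using (List; map; allFin)
open import Data.Nat.ListAction using (sum)
open import Data.Bool using (if_then_else_)
open import Data.Product using (_×_; ∃)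
open import Data.Sum using (_⊎_)
open import Relation.Nullary using (¬_)
open import Relation.Nullary.Decidable using (isYes)
open import Relation.Binary.PropositionalEquality using (_≡_; _≢_)

Design : ℕ → ℕ → ℕ → Set
Design r c v = Fin r → Fin c → Fin v

∑ : (n : ℕ) → (Fin n → ℕ) → ℕ
∑ n f = sum (map f (allFin n))

-- Floor and ceiling of a / b (natural numbers); b = 0 never arises below
-- for the designs considered (v ≥ 1 since rc > 0; r c ≥ 2), the value 0 is a dummy.
⌊_/_⌋ : ℕ → ℕ → ℕ
⌊ a / zero ⌋ = 0
⌊ a / suc b ⌋ = a / suc b

⌈_/_⌉ : ℕ → ℕ → ℕ
⌈ a / zero ⌉ = 0
⌈ a / suc b ⌉ = (a + b) / suc b

module _ {r c v : ℕ} (T : Design r c v) where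

  Binary : Set
  Binary = (∀ i j j' → T i j ≡ T i j' → j ≡ j')
         × (∀ i i' j → T i j ≡ T i' j → i ≡ i')

  occ : Fin v → ℕ
  occ s = ∑ r (λ i → ∑ c (λ j → if isYes (T i j ≟ s) then 1 else 0))

  rowSet : Fin r → Subset v
  rowSet i = ⋃ (map (λ j → ⁅ T i j ⁆) (allFin c))

  colSet : Fin c → Subset v
  colSet j = ⋃ (map (λ i → ⁅ T i j ⁆) (allFin r))

  rc-int : Fin r → Fin c → ℕ
  rc-int i j = ∣ rowSet i ∩ colSet j ∣

  rr-int : Fin r → Fin r → ℕ
  rr-int i i' = ∣ rowSet i ∩ rowSet i' ∣

  cc-int : Fin c → Fin c → ℕ
  cc-int j j' = ∣ colSet j ∩ colSet j' ∣

  -- numerators of λ_rc, λ_rr, λ_cc (sums over i,j resp. over pairs i < j)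
  Src : ℕ
  Src = ∑ r (λ i → ∑ c (λ j → rc-int i j))

  Srr : ℕ
  Srr = ∑ r (λ i → ∑ r (λ i' → if isYes (i <? i') then rr-int i i' else 0))

  Scc : ℕ
  Scc = ∑ c (λ j → ∑ c (λ j' → if isYes (j <? j') then cc-int j j' else 0))

  Equireplicate : Set
  Equireplicate = (v ∣ r * c) × (∀ s → occ s ≡ ⌊ r * c / v ⌋)

  NearEquireplicate : Set
  NearEquireplicate = ¬ (v ∣ r * c)
    × (∀ s → occ s ≡ ⌊ r * c / v ⌋ ⊎ occ s ≡ ⌈ r * c / v ⌉)

  RowColBalanced : Set
  RowColBalanced = ∀ i j → rc-int i j ≡ ⌊ Src / (r * c) ⌋ ⊎ rc-int i j ≡ ⌈ Src / (r * c) ⌉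

  RowRowBalanced : Set
  RowRowBalanced = ∀ i i' → i ≢ i' →
    rr-int i i' ≡ ⌊ Srr / (r C 2) ⌋ ⊎ rr-int i i' ≡ ⌈ Srr / (r C 2) ⌉

  ColColBalanced : Set
  ColColBalanced = ∀ j j' → j ≢ j' →
    cc-int j j' ≡ ⌊ Scc / (c C 2) ⌋ ⊎ cc-int j j' ≡ ⌈ Scc / (c C 2) ⌉

  NearTripleArray : Set
  NearTripleArray = Binary × (Equireplicate ⊎ NearEquireplicate)
    × RowColBalanced × RowRowBalanced × ColColBalanced

  OneOf : ℤ → ℕ → Set
  OneOf x n = (+ n ≡ x) ⊎ (+ n ≡ x ℤ.+ ℤ.1ℤ)

  Conditions : ℤ → ℤ → ℤ → ℤ → Set
  Conditions x xrc xrr xcc =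
      (∀ s → OneOf x (occ s))
    × (∀ i j → OneOf xrc (rc-int i j))
    × (∀ i i' → i ≢ i' → OneOf xrr (rr-int i i'))
    × (∀ j j' → j ≢ j' → OneOf xcc (cc-int j j'))

{-# OPTIONS --safe #-}
module Submission where

-- If every entry of a nonempty family of naturals is m or m + 1, then the sum S
-- of its N entries satisfies N m ≤ S ≤ N (m + 1), the upper bound being strict
-- if some entry is m and the lower one strict if some entry is m + 1.  Hence an
-- entry equal to m is ⌊S / N⌋ and an entry equal to m + 1 is ⌈S / N⌉.  This
-- applies to the replications (S = rc by double counting, N = v), to the
-- row–column intersections (N = rc), and to the intersections of pairs of
-- distinct rows (resp. columns), enumerated as the r C 2 (resp. c C 2) pairs
-- i < i'.  Conversely ⌊q⌋ ≤ ⌈q⌉ ≤ ⌊q⌋ + 1, so x = ⌊λ⌋ satisfies (1)–(4); and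
-- ⌈rc / v⌉ = ⌊rc / v⌋ when v ∣ rc, which yields the equireplicate case.

open import Defs

open import Algebra.Properties.CommutativeSemigroup using (interchange)
open import Data.Bool using (Bool; true; false; if_then_else_)
open import Data.Fin as Fin using (Fin; zero; suc)
open import Data.Fin.Properties using (_≟_; _<?_; <-cmp; <⇒≢; suc-injective)
open import Data.Fin.Subset using (∣_∣)
open import Data.Fin.Subset.Properties using (∩-comm)
open import Data.Integer as ℤ using (ℤ; -[1+_]; 1ℤ)
open import Data.Integer.Properties using (+-injective)
open import Data.List using (List; []; _∷_; _++_; map; allFin; length; filter; cartesianProduct)
open import Data.List.Membership.Propositional using (_∈_; lose)
open import Data.List.Membership.Propositional.Properties
  using (∈-map⁺; ∈-allFin; ∈-filter⁺; ∈-filter⁻; ∈-cartesianProduct⁺)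
open import Data.List.Properties
  using (map-++; map-∘; map-cong; map-tabulate; length-map; length-++; length-tabulate)
open import Data.List.Relation.Unary.All as All using (All; []; _∷_)
import Data.List.Relation.Unary.All.Properties as All
open import Data.List.Relation.Unary.Any using (Any; here; there)
open import Data.Nat using (ℕ; zero; suc; _+_; _*_; _≤_; _<_; z≤n; s≤s; s≤s⁻¹)
open import Data.Nat.Combinatorics using (_C_; nC1≡n; nCk+nC[k+1]≡[n+1]C[k+1])
open import Data.Nat.DivMod
  using (_/_; m*n/n≡m; /-monoˡ-≤; m<n*o⇒m/o<n; +-distrib-/-∣ʳ; +-distrib-/-∣ˡ; n/n≡1; m<n⇒m/n≡0)
open import Data.Nat.Divisibility using (_∣_; _∣?_; ∣-refl)
open import Data.Nat.ListAction using (sum)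
open import Data.Nat.ListAction.Properties using (sum-++)
open import Data.Nat.Properties
  using ( ≤-refl; ≤-antisym; n≤1+n; n<1+n; m≤m+n; m≤n⇒m<n∨m≡n
        ; +-comm; +-suc; +-identityʳ; *-comm; *-suc; *-zeroʳ; *-identityʳ
        ; +-mono-≤; +-monoʳ-≤; +-mono-≤-<; +-mono-<-≤; +-commutativeSemigroup
        ; module ≤-Reasoning)
open import Data.Product using (_×_; _,_; ∃-syntax; proj₂; uncurry)
open import Data.Sum using (_⊎_; inj₁; inj₂)
open import Function using (_∘_; _⇔_; mk⇔)
open import Relation.Binary using (tri<; tri≈; tri>)
open import Relation.Binary.PropositionalEquality
  using (_≡_; _≢_; refl; sym; trans; cong; cong₂; subst; subst₂; module ≡-Reasoning)
open import Relation.Nullary using (Dec; yes; no; ¬_; contradiction)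
open import Relation.Nullary.Decidable using (isYes; isYes≗does; does-⇔; dec-true; dec-false)

OneOfℕ : ℕ → ℕ → Set
OneOfℕ m n = n ≡ m ⊎ n ≡ suc m

OneOfℕ⇒≥ : ∀ {m n} → OneOfℕ m n → m ≤ n
OneOfℕ⇒≥ (inj₁ refl) = ≤-refl
OneOfℕ⇒≥ (inj₂ refl) = n≤1+n _

OneOfℕ⇒≤suc : ∀ {m n} → OneOfℕ m n → n ≤ suc m
OneOfℕ⇒≤suc (inj₁ refl) = n≤1+n _
OneOfℕ⇒≤suc (inj₂ refl) = ≤-refl

m≤n≤1+m⇒OneOfℕ : ∀ {m n} → m ≤ n → n ≤ suc m → OneOfℕ m n
m≤n≤1+m⇒OneOfℕ m≤n n≤1+m with m≤n⇒m<n∨m≡n m≤n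
... | inj₁ m<n = inj₂ (≤-antisym n≤1+m m<n)
... | inj₂ m≡n = inj₁ (sym m≡n)

-- Defs' OneOf without its (unused) design parameter.
OneOfℤ : ℤ → ℕ → Set
OneOfℤ x n = (ℤ.+ n ≡ x) ⊎ (ℤ.+ n ≡ x ℤ.+ 1ℤ)

OneOfℕ⇒OneOfℤ : ∀ {m n} → OneOfℕ m n → OneOfℤ (ℤ.+ m) n
OneOfℕ⇒OneOfℤ (inj₁ refl) = inj₁ refl
OneOfℕ⇒OneOfℤ {m} (inj₂ refl) = inj₂ (cong ℤ.+_ (+-comm 1 m))

-- x = -1 allows only the value 0, and x < -1 no value at all.
OneOfℤ⇒OneOfℕ : (x : ℤ) → ∃[ m ] (∀ {n} → OneOfℤ x n → OneOfℕ m n)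
OneOfℤ⇒OneOfℕ (ℤ.+ m) = m , λ where
  (inj₁ refl) → inj₁ refl
  (inj₂ n≡m+1) → inj₂ (trans (+-injective n≡m+1) (+-comm m 1))
OneOfℤ⇒OneOfℕ -[1+ 0 ] = 0 , λ where
  (inj₂ refl) → inj₁ refl
OneOfℤ⇒OneOfℕ -[1+ suc k ] = 0 , λ where
  (inj₂ ())

FloorOrCeil : ℕ → ℕ → ℕ → Set
FloorOrCeil a b n = n ≡ ⌊ a / b ⌋ ⊎ n ≡ ⌈ a / b ⌉

⌊/⌋-unique : ∀ {a m} n → suc n * m ≤ a → a < suc n * suc m → ⌊ a / suc n ⌋ ≡ m
⌊/⌋-unique {a} {m} n lo hi = ≤-antisym
  (s≤s⁻¹ (m<n*o⇒m/o<n (subst (a <_) (*-comm (suc n) (suc m)) hi)))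
  (begin
    m                 ≡⟨ m*n/n≡m m (suc n) ⟨
    m * suc n / suc n ≤⟨ /-monoˡ-≤ (suc n) (subst (_≤ a) (*-comm (suc n) m) lo) ⟩
    a / suc n         ∎)
  where open ≤-Reasoning

⌈/⌉-unique : ∀ {a m} n → suc n * m < a → a ≤ suc n * suc m → ⌈ a / suc n ⌉ ≡ suc m
⌈/⌉-unique {a} {m} n lo hi = ⌊/⌋-unique n lo′ hi′
  where
  open ≤-Reasoning
  lo′ : suc n * suc m ≤ a + n
  lo′ = begin
    suc n * suc m         ≡⟨ *-suc (suc n) m ⟩
    suc n + suc n * m     ≡⟨ +-suc n (suc n * m) ⟨
    n + suc (suc n * m)   ≤⟨ +-monoʳ-≤ n lo ⟩
    n + a                 ≡⟨ +-comm n a ⟩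
    a + n                 ∎
  hi′ : a + n < suc n * suc (suc m)
  hi′ = begin-strict
    a + n                 <⟨ +-mono-≤-< hi (n<1+n n) ⟩
    suc n * suc m + suc n ≡⟨ +-comm (suc n * suc m) (suc n) ⟩
    suc n + suc n * suc m ≡⟨ *-suc (suc n) (suc m) ⟨
    suc n * suc (suc m)   ∎

⌈/⌉-OneOfℕ : ∀ a b → OneOfℕ ⌊ a / b ⌋ ⌈ a / b ⌉
⌈/⌉-OneOfℕ a zero = inj₁ refl
⌈/⌉-OneOfℕ a (suc n) = m≤n≤1+m⇒OneOfℕ (/-monoˡ-≤ (suc n) (m≤m+n a n)) (begin
  (a + n) / suc n            ≤⟨ /-monoˡ-≤ (suc n) (+-monoʳ-≤ a (n≤1+n n)) ⟩
  (a + suc n) / suc n        ≡⟨ +-distrib-/-∣ʳ a ∣-refl ⟩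
  a / suc n + suc n / suc n  ≡⟨ cong (a / suc n +_) (n/n≡1 (suc n)) ⟩
  a / suc n + 1              ≡⟨ +-comm (a / suc n) 1 ⟩
  suc (a / suc n)            ∎)
  where open ≤-Reasoning

∣⇒⌈/⌉≡⌊/⌋ : ∀ {a} b → b ∣ a → ⌈ a / b ⌉ ≡ ⌊ a / b ⌋
∣⇒⌈/⌉≡⌊/⌋ zero _ = refl
∣⇒⌈/⌉≡⌊/⌋ {a} (suc n) b∣a = begin
  (a + n) / suc n         ≡⟨ +-distrib-/-∣ˡ n b∣a ⟩
  a / suc n + n / suc n   ≡⟨ cong (a / suc n +_) (m<n⇒m/n≡0 (n<1+n n)) ⟩
  a / suc n + 0           ≡⟨ +-identityʳ (a / suc n) ⟩
  a / suc n               ∎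
  where open ≡-Reasoning

FloorOrCeil⇒OneOfℤ : ∀ a b {n} → FloorOrCeil a b n → OneOfℤ (ℤ.+ ⌊ a / b ⌋) n
FloorOrCeil⇒OneOfℤ a b (inj₁ refl) = inj₁ refl
FloorOrCeil⇒OneOfℤ a b (inj₂ refl) = OneOfℕ⇒OneOfℤ (⌈/⌉-OneOfℕ a b)

∣⇒FloorOrCeil⇒≡⌊/⌋ : ∀ {a} b {n} → b ∣ a → FloorOrCeil a b n → n ≡ ⌊ a / b ⌋
∣⇒FloorOrCeil⇒≡⌊/⌋ b b∣a (inj₁ n≡⌊a/b⌋) = n≡⌊a/b⌋
∣⇒FloorOrCeil⇒≡⌊/⌋ b b∣a (inj₂ n≡⌈a/b⌉) = trans n≡⌈a/b⌉ (∣⇒⌈/⌉≡⌊/⌋ b b∣a)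

length*m≤sum : ∀ {m ys} → All (m ≤_) ys → length ys * m ≤ sum ys
length*m≤sum [] = z≤n
length*m≤sum (m≤y ∷ m≤ys) = +-mono-≤ m≤y (length*m≤sum m≤ys)

length*m<sum : ∀ {m ys} → All (m ≤_) ys → Any (m <_) ys → length ys * m < sum ys
length*m<sum (_ ∷ m≤ys) (here m<y) = +-mono-<-≤ m<y (length*m≤sum m≤ys)
length*m<sum (m≤y ∷ m≤ys) (there m<ys) = +-mono-≤-< m≤y (length*m<sum m≤ys m<ys)

sum≤length*m : ∀ {m ys} → All (_≤ m) ys → sum ys ≤ length ys * m
sum≤length*m [] = z≤n
sum≤length*m (y≤m ∷ ys≤m) = +-mono-≤ y≤m (sum≤length*m ys≤m)

sum<length*m : ∀ {m ys} → All (_≤ m) ys → Any (_< m) ys → sum ys < length ys * m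
sum<length*m (_ ∷ ys≤m) (here y<m) = +-mono-<-≤ y<m (sum≤length*m ys≤m)
sum<length*m (y≤m ∷ ys≤m) (there ys<m) = +-mono-≤-< y≤m (sum<length*m ys≤m ys<m)

OneOfℕ⇒FloorOrCeil-average : ∀ {m y ys} → All (OneOfℕ m) ys → y ∈ ys →
  FloorOrCeil (sum ys) (length ys) y
OneOfℕ⇒FloorOrCeil-average {m} {ys = _ ∷ zs} ys∈m,1+m y∈ys
  with All.lookup ys∈m,1+m y∈ys
... | inj₁ refl = inj₁ (sym (⌊/⌋-unique (length zs)
        (length*m≤sum (All.map OneOfℕ⇒≥ ys∈m,1+m))
        (sum<length*m (All.map OneOfℕ⇒≤suc ys∈m,1+m) (lose y∈ys (n<1+n m)))))
... | inj₂ refl = inj₂ (sym (⌈/⌉-unique (length zs)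
        (length*m<sum (All.map OneOfℕ⇒≥ ys∈m,1+m) (lose y∈ys (n<1+n m)))
        (sum≤length*m (All.map OneOfℕ⇒≤suc ys∈m,1+m))))

private variable A B : Set

OneOfℤ⇒FloorOrCeil-average : ∀ (f : A → ℕ) (is : List A) {x} →
  (∀ {i} → i ∈ is → OneOfℤ x (f i)) →
  ∀ {i} → i ∈ is → FloorOrCeil (sum (map f is)) (length is) (f i)
OneOfℤ⇒FloorOrCeil-average f is {x} oneOf {i} i∈is =
  let (_ , oneOfℕ) = OneOfℤ⇒OneOfℕ x in
  subst (λ N → FloorOrCeil (sum (map f is)) N (f i)) (length-map f is)
    (OneOfℕ⇒FloorOrCeil-average (All.map⁺ (All.tabulate (oneOfℕ ∘ oneOf))) (∈-map⁺ f i∈is))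

sum-map-const : ∀ k (xs : List A) → sum (map (λ _ → k) xs) ≡ length xs * k
sum-map-const k [] = refl
sum-map-const k (x ∷ xs) = cong (k +_) (sum-map-const k xs)

sum-map-+ : ∀ (f g : A → ℕ) xs → sum (map (λ x → f x + g x) xs) ≡ sum (map f xs) + sum (map g xs)
sum-map-+ f g [] = refl
sum-map-+ f g (x ∷ xs) = begin
  f x + g x + sum (map (λ x → f x + g x) xs)
    ≡⟨ cong (f x + g x +_) (sum-map-+ f g xs) ⟩
  f x + g x + (sum (map f xs) + sum (map g xs))
    ≡⟨ interchange +-commutativeSemigroup (f x) (g x) _ _ ⟩
  f x + sum (map f xs) + (g x + sum (map g xs)) ∎
  where open ≡-Reasoning

sum-map-swap : ∀ (f : A → B → ℕ) xs ys →
  sum (map (λ x → sum (map (f x) ys)) xs) ≡ sum (map (λ y → sum (map (λ x → f x y) xs)) ys)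
sum-map-swap f [] ys = sym (trans (sum-map-const 0 ys) (*-zeroʳ (length ys)))
sum-map-swap f (x ∷ xs) ys = begin
  sum (map (f x) ys) + sum (map (λ x → sum (map (f x) ys)) xs)
    ≡⟨ cong (sum (map (f x) ys) +_) (sum-map-swap f xs ys) ⟩
  sum (map (f x) ys) + sum (map (λ y → sum (map (λ x → f x y) xs)) ys)
    ≡⟨ sum-map-+ (f x) (λ y → sum (map (λ x → f x y) xs)) ys ⟨
  sum (map (λ y → f x y + sum (map (λ x → f x y) xs)) ys) ∎
  where open ≡-Reasoning

sum-map-cartesianProduct : ∀ (f : A × B → ℕ) xs ys →
  sum (map f (cartesianProduct xs ys)) ≡ sum (map (λ x → sum (map (λ y → f (x , y)) ys)) xs)
sum-map-cartesianProduct f [] ys = refl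
sum-map-cartesianProduct f (x ∷ xs) ys = begin
  sum (map f (map (x ,_) ys ++ cartesianProduct xs ys))
    ≡⟨ cong sum (map-++ f (map (x ,_) ys) _) ⟩
  sum (map f (map (x ,_) ys) ++ map f (cartesianProduct xs ys))
    ≡⟨ sum-++ (map f (map (x ,_) ys)) _ ⟩
  sum (map f (map (x ,_) ys)) + sum (map f (cartesianProduct xs ys))
    ≡⟨ cong₂ _+_ (cong sum (sym (map-∘ ys))) (sum-map-cartesianProduct f xs ys) ⟩
  sum (map (λ y → f (x , y)) ys) + sum (map (λ x → sum (map (λ y → f (x , y)) ys)) xs) ∎
  where open ≡-Reasoning

length-cartesianProduct : ∀ (xs : List A) (ys : List B) →
  length (cartesianProduct xs ys) ≡ length xs * length ys
length-cartesianProduct [] ys = refl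
length-cartesianProduct (x ∷ xs) ys = begin
  length (map (x ,_) ys ++ cartesianProduct xs ys)
    ≡⟨ length-++ (map (x ,_) ys) ⟩
  length (map (x ,_) ys) + length (cartesianProduct xs ys)
    ≡⟨ cong₂ _+_ (length-map (x ,_) ys) (length-cartesianProduct xs ys) ⟩
  length ys + length xs * length ys ∎
  where open ≡-Reasoning

sum-map-filter : ∀ {P : A → Set} (P? : ∀ x → Dec (P x)) (f : A → ℕ) xs →
  sum (map f (filter P? xs)) ≡ sum (map (λ x → if isYes (P? x) then f x else 0) xs)
sum-map-filter P? f [] = refl
sum-map-filter P? f (x ∷ xs) with P? x
... | yes _ = cong (f x +_) (sum-map-filter P? f xs)
... | no _ = sum-map-filter P? f xs

bit : Bool → ℕ
bit b = if b then 1 else 0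

isYes-⇔ : ∀ {P Q : Set} → P ⇔ Q → (p? : Dec P) (q? : Dec Q) → isYes p? ≡ isYes q?
isYes-⇔ P⇔Q p? q? = trans (isYes≗does p?) (trans (does-⇔ P⇔Q p? q?) (sym (isYes≗does q?)))

isYes-true : ∀ {P : Set} (p? : Dec P) → P → isYes p? ≡ true
isYes-true p? p = trans (isYes≗does p?) (dec-true p? p)

isYes-false : ∀ {P : Set} (p? : Dec P) → ¬ P → isYes p? ≡ false
isYes-false p? ¬p = trans (isYes≗does p?) (dec-false p? ¬p)

length-allFin : ∀ n → length (allFin n) ≡ n
length-allFin n = length-tabulate (λ i → i)

∑-cong : ∀ n {f g : Fin n → ℕ} → (∀ i → f i ≡ g i) → ∑ n f ≡ ∑ n g
∑-cong n f≗g = cong sum (map-cong f≗g (allFin n))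

∑-const : ∀ n k → ∑ n (λ _ → k) ≡ n * k
∑-const n k = trans (sum-map-const k (allFin n)) (cong (_* k) (length-allFin n))

∑-suc : ∀ n (f : Fin (suc n) → ℕ) → ∑ (suc n) f ≡ f zero + ∑ n (f ∘ suc)
∑-suc n f = cong (λ xs → f zero + sum xs)
  (trans (map-tabulate suc f) (sym (map-tabulate (λ i → i) (f ∘ suc))))

∑-≟ : ∀ {n} (t : Fin n) → ∑ n (λ s → bit (isYes (t ≟ s))) ≡ 1
∑-≟ {suc n} zero = trans (∑-suc n (λ s → bit (isYes (zero ≟ s))))
  (cong suc (trans (∑-const n 0) (*-zeroʳ n)))
∑-≟ {suc n} (suc t) = trans (∑-suc n (λ s → bit (isYes (suc t ≟ s)))) (trans
  (∑-cong n (λ s → cong bit (isYes-⇔ (mk⇔ suc-injective (cong suc)) (suc t ≟ suc s) (t ≟ s))))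
  (∑-≟ t))

∑< : ∀ n → (Fin n → Fin n → ℕ) → ℕ
∑< n w = ∑ n (λ i → ∑ n (λ i' → if isYes (i <? i') then w i i' else 0))

∑<-1≡nC2 : ∀ n → ∑< n (λ _ _ → 1) ≡ n C 2
∑<-1≡nC2 zero = refl
∑<-1≡nC2 (suc n) = begin
  ∑ (suc n) (λ i → ∑ (suc n) (λ i' → bit (isYes (i <? i'))))
    ≡⟨ ∑-suc n _ ⟩
  ∑ (suc n) (λ i' → bit (isYes (zero {n} <? i')))
    + ∑ n (λ i → ∑ (suc n) (λ i' → bit (isYes (suc i <? i'))))
    ≡⟨ cong₂ _+_ zero<-count (trans (∑-cong n suc<-count) (∑<-1≡nC2 n)) ⟩
  n + n C 2
    ≡⟨ cong (_+ n C 2) (nC1≡n n) ⟨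
  n C 1 + n C 2
    ≡⟨ nCk+nC[k+1]≡[n+1]C[k+1] n 1 ⟩
  suc n C 2 ∎
  where
  open ≡-Reasoning
  zero<-count : ∑ (suc n) (λ i' → bit (isYes (zero {n} <? i'))) ≡ n
  zero<-count = begin
    ∑ (suc n) (λ i' → bit (isYes (zero {n} <? i')))
      ≡⟨ ∑-suc n (λ i' → bit (isYes (zero {n} <? i'))) ⟩
    bit (isYes (zero {n} <? zero {n})) + ∑ n (λ i' → bit (isYes (zero {n} <? suc i')))
      ≡⟨ cong₂ _+_ (cong bit (isYes-false (zero {n} <? zero {n}) (λ ())))
                   (∑-cong n (λ i' → cong bit (isYes-true (zero {n} <? suc i') (s≤s z≤n)))) ⟩
    ∑ n (λ _ → 1)
      ≡⟨ trans (∑-const n 1) (*-identityʳ n) ⟩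
    n ∎
  suc<-count : ∀ i →
    ∑ (suc n) (λ i' → bit (isYes (suc i <? i'))) ≡ ∑ n (λ i' → bit (isYes (i <? i')))
  suc<-count i = begin
    ∑ (suc n) (λ i' → bit (isYes (suc i <? i')))
      ≡⟨ ∑-suc n (λ i' → bit (isYes (suc i <? i'))) ⟩
    bit (isYes (suc i <? zero {n})) + ∑ n (λ i' → bit (isYes (suc i <? suc i')))
      ≡⟨ cong₂ _+_ (cong bit (isYes-false (suc i <? zero {n}) (λ ())))
                   (∑-cong n (λ i' → cong bit
                     (isYes-⇔ (mk⇔ s≤s⁻¹ s≤s) (suc i <? suc i') (i <? i')))) ⟩
    ∑ n (λ i' → bit (isYes (i <? i'))) ∎

Fin-FloorOrCeil-average : ∀ {n x} (f : Fin n → ℕ) → (∀ i → OneOfℤ x (f i)) →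
  ∀ i → FloorOrCeil (∑ n f) n (f i)
Fin-FloorOrCeil-average {n} f oneOf i = subst (λ N → FloorOrCeil (∑ n f) N (f i)) (length-allFin n)
  (OneOfℤ⇒FloorOrCeil-average f (allFin n) (λ {i} _ → oneOf i) (∈-allFin i))

Fin²-FloorOrCeil-average : ∀ {m n x} (w : Fin m → Fin n → ℕ) → (∀ i j → OneOfℤ x (w i j)) →
  ∀ i j → FloorOrCeil (∑ m (λ i → ∑ n (w i))) (m * n) (w i j)
Fin²-FloorOrCeil-average {m} {n} w oneOf i j = subst₂ (λ S N → FloorOrCeil S N (w i j))
  (sum-map-cartesianProduct (uncurry w) (allFin m) (allFin n))
  (trans (length-cartesianProduct (allFin m) (allFin n)) (cong₂ _*_ (length-allFin m) (length-allFin n)))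
  (OneOfℤ⇒FloorOrCeil-average (uncurry w) (cartesianProduct (allFin m) (allFin n))
    (λ {(i , j)} _ → oneOf i j) (∈-cartesianProduct⁺ (∈-allFin i) (∈-allFin j)))

orderedPairs : ∀ n → List (Fin n × Fin n)
orderedPairs n = filter (uncurry _<?_) (cartesianProduct (allFin n) (allFin n))

∈-orderedPairs⁺ : ∀ {n} {i i' : Fin n} → i Fin.< i' → (i , i') ∈ orderedPairs n
∈-orderedPairs⁺ {i = i} {i'} =
  ∈-filter⁺ (uncurry _<?_) (∈-cartesianProduct⁺ (∈-allFin i) (∈-allFin i'))

∈-orderedPairs⁻ : ∀ {n} {i i' : Fin n} → (i , i') ∈ orderedPairs n → i Fin.< i'
∈-orderedPairs⁻ {n} = proj₂ ∘ ∈-filter⁻ (uncurry _<?_) {xs = cartesianProduct (allFin n) (allFin n)}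

sum-orderedPairs : ∀ n (w : Fin n → Fin n → ℕ) →
  sum (map (uncurry w) (orderedPairs n)) ≡ ∑< n w
sum-orderedPairs n w = trans
  (sum-map-filter (uncurry _<?_) (uncurry w) (cartesianProduct (allFin n) (allFin n)))
  (sum-map-cartesianProduct _ (allFin n) (allFin n))

length-orderedPairs : ∀ n → length (orderedPairs n) ≡ n C 2
length-orderedPairs n = begin
  length (orderedPairs n)                  ≡⟨ *-identityʳ _ ⟨
  length (orderedPairs n) * 1              ≡⟨ sum-map-const 1 (orderedPairs n) ⟨
  sum (map (λ _ → 1) (orderedPairs n))     ≡⟨ sum-orderedPairs n (λ _ _ → 1) ⟩
  ∑< n (λ _ _ → 1)                         ≡⟨ ∑<-1≡nC2 n ⟩
  n C 2                                    ∎
  where open ≡-Reasoning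

<-FloorOrCeil-average : ∀ {n x} (w : Fin n → Fin n → ℕ) →
  (∀ i i' → i ≢ i' → OneOfℤ x (w i i')) → ∀ {i i'} → i Fin.< i' → FloorOrCeil (∑< n w) (n C 2) (w i i')
<-FloorOrCeil-average {n} w oneOf {i} {i'} i<i' = subst₂ (λ S N → FloorOrCeil S N (w i i'))
  (sum-orderedPairs n w) (length-orderedPairs n)
  (OneOfℤ⇒FloorOrCeil-average (uncurry w) (orderedPairs n)
    (λ {(i , i')} p∈ → oneOf i i' (<⇒≢ (∈-orderedPairs⁻ p∈))) (∈-orderedPairs⁺ i<i'))

≢-FloorOrCeil-average : ∀ {n x} (w : Fin n → Fin n → ℕ) → (∀ i i' → w i i' ≡ w i' i) →
  (∀ i i' → i ≢ i' → OneOfℤ x (w i i')) → ∀ i i' → i ≢ i' →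
  FloorOrCeil (∑< n w) (n C 2) (w i i')
≢-FloorOrCeil-average {n} w w-sym oneOf i i' i≢i' with <-cmp i i'
... | tri< i<i' _ _ = <-FloorOrCeil-average w oneOf i<i'
... | tri≈ _ i≡i' _ = contradiction i≡i' i≢i'
... | tri> _ _ i'<i =
  subst (FloorOrCeil (∑< n w) (n C 2)) (w-sym i' i) (<-FloorOrCeil-average w oneOf i'<i)

module _ {r c v : ℕ} (T : Design r c v) where

  ∑-occ : ∑ v (occ T) ≡ r * c
  ∑-occ = begin
    ∑ v (λ s → ∑ r (λ i → ∑ c (λ j → bit (isYes (T i j ≟ s)))))
      ≡⟨ sum-map-swap (λ s i → ∑ c (λ j → bit (isYes (T i j ≟ s)))) (allFin v) (allFin r) ⟩
    ∑ r (λ i → ∑ v (λ s → ∑ c (λ j → bit (isYes (T i j ≟ s)))))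
      ≡⟨ ∑-cong r (λ i → sum-map-swap (λ s j → bit (isYes (T i j ≟ s))) (allFin v) (allFin c)) ⟩
    ∑ r (λ i → ∑ c (λ j → ∑ v (λ s → bit (isYes (T i j ≟ s)))))
      ≡⟨ ∑-cong r (λ i → ∑-cong c (λ j → ∑-≟ (T i j))) ⟩
    ∑ r (λ _ → ∑ c (λ _ → 1))
      ≡⟨ ∑-cong r (λ _ → trans (∑-const c 1) (*-identityʳ c)) ⟩
    ∑ r (λ _ → c)
      ≡⟨ ∑-const r c ⟩
    r * c ∎
    where open ≡-Reasoning

  occ-FloorOrCeil : ∀ {x} → (∀ s → OneOfℤ x (occ T s)) → ∀ s → FloorOrCeil (r * c) v (occ T s)
  occ-FloorOrCeil oneOf s =
    subst (λ S → FloorOrCeil S v (occ T s)) ∑-occ (Fin-FloorOrCeil-average (occ T) oneOf s)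

  occ-FloorOrCeil⇒replicate : (∀ s → FloorOrCeil (r * c) v (occ T s)) →
    Equireplicate T ⊎ NearEquireplicate T
  occ-FloorOrCeil⇒replicate balanced with v ∣? r * c
  ... | yes v∣rc = inj₁ (v∣rc , λ s → ∣⇒FloorOrCeil⇒≡⌊/⌋ v v∣rc (balanced s))
  ... | no v∤rc = inj₂ (v∤rc , balanced)

  replicate⇒occ-FloorOrCeil : Equireplicate T ⊎ NearEquireplicate T →
    ∀ s → FloorOrCeil (r * c) v (occ T s)
  replicate⇒occ-FloorOrCeil (inj₁ (_ , occ≡)) s = inj₁ (occ≡ s)
  replicate⇒occ-FloorOrCeil (inj₂ (_ , balanced)) = balanced

  rr-int-sym : ∀ i i' → rr-int T i i' ≡ rr-int T i' i
  rr-int-sym i i' = cong ∣_∣ (∩-comm (rowSet T i) (rowSet T i'))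

  cc-int-sym : ∀ j j' → cc-int T j j' ≡ cc-int T j' j
  cc-int-sym j j' = cong ∣_∣ (∩-comm (colSet T j) (colSet T j'))

proposition2p6 : (r c v : ℕ) → 2 ≤ r → 2 ≤ c → (T : Design r c v) →
    ((Binary T → (x xrc xrr xcc : ℤ) → Conditions T x xrc xrr xcc → NearTripleArray T)
    × (NearTripleArray T → ∃[ x ] ∃[ xrc ] ∃[ xrr ] ∃[ xcc ] Conditions T x xrc xrr xcc))
proposition2p6 r c v _ _ T = sufficient , necessary
  where
  sufficient : Binary T → (x xrc xrr xcc : ℤ) → Conditions T x xrc xrr xcc → NearTripleArray T
  sufficient binary _ _ _ _ (occ∈ , rc∈ , rr∈ , cc∈) =
    binary ,
    occ-FloorOrCeil⇒replicate T (occ-FloorOrCeil T occ∈) ,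
    Fin²-FloorOrCeil-average (rc-int T) rc∈ ,
    ≢-FloorOrCeil-average (rr-int T) (rr-int-sym T) rr∈ ,
    ≢-FloorOrCeil-average (cc-int T) (cc-int-sym T) cc∈

  necessary : NearTripleArray T → ∃[ x ] ∃[ xrc ] ∃[ xrr ] ∃[ xcc ] Conditions T x xrc xrr xcc
  necessary (_ , replicated , rc , rr , cc) =
    ℤ.+ ⌊ r * c / v ⌋ , ℤ.+ ⌊ Src T / (r * c) ⌋ ,
    ℤ.+ ⌊ Srr T / (r C 2) ⌋ , ℤ.+ ⌊ Scc T / (c C 2) ⌋ ,
    (λ s → FloorOrCeil⇒OneOfℤ (r * c) v (replicate⇒occ-FloorOrCeil T replicated s)) ,
    (λ i j → FloorOrCeil⇒OneOfℤ (Src T) (r * c) (rc i j)) ,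
    (λ i i' i≢i' → FloorOrCeil⇒OneOfℤ (Srr T) (r C 2) (rr i i' i≢i')) ,
    (λ j j' j≢j' → FloorOrCeil⇒OneOfℤ (Scc T) (c C 2) (cc j j' j≢j'))
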